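{- Let $n,D,k$ be integers with $n\ge 4$, $3\le D\le n-1$ and $0\le k\le n-D-1$. Then \[ \xi^c(G_{n,D,k}) = 2\sum_{i=0}^{D-1}\max\{i,D-i\} + (n-D-1)\bigl(2D-1+D(n-D)\bigr) + k\bigl(2D-n-1+\max\{2,D-2\}\bigr). \]
   Context: For a connected graph $G=(V,E)$, $\mathrm{ecc}(v)=\max_{w\in V}\mathrm{dist}(v,w)$ and the eccentric connectivity index is $\xi^c(G)=\sum_{v\in V}\deg(v)\,\mathrm{ecc}(v)$. For integers $n\ge4$, $3\le D\le n-1$, $0\le k\le n-D-1$, the graph $G_{n,D,k}$ (of order $n$ and diameter $D$) is constructed from a path $u_0-u_1-\cdots-u_D$ and a clique $K_{n-D-1}$ disjoint from it by joining every vertex of the clique to $u_0$ and $u_1$, and joining $k$ of the clique vertices to $u_2$. -}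

module Defs where

open import Data.Nat using (ℕ; zero; suc; _+_; _*_; _∸_; _⊔_; _<ᵇ_; _≡ᵇ_)
open import Data.Bool using (Bool; true; false; _∧_; _∨_; not; if_then_else_)
open import Data.Fin using (Fin; toℕ)
open import Data.List using (List; map; upTo; foldr)
open import Data.Nat.ListAction using (sum)
open import Data.List using (allFin) public
open import Data.Integer using (ℤ)

-- Finite simple graphs on vertex set Fin n, given by a (symmetric,
-- irreflexive) Boolean adjacency function.

Graph : ℕ → Set
Graph n = Fin n → Fin n → Bool

module _ {n : ℕ} (G : Graph n) where

  vertices : List (Fin n)
  vertices = allFin n

  anyL : {A : Set} → (A → Bool) → List A → Bool
  anyL p = foldr (λ x b → p x ∨ b) false

  count : {A : Set} → (A → Bool) → List A → ℕ
  count p = foldr (λ x c → (if p x then 1 else 0) + c) 0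

  deg : Fin n → ℕ
  deg v = count (G v) vertices

  _==_ : Fin n → Fin n → Bool
  a == b = toℕ a ≡ᵇ toℕ b

  within : ℕ → Fin n → Fin n → Bool
  within zero    v w = v == w
  within (suc j) v w = within j v w ∨ anyL (λ u → within j v u ∧ G u w) vertices

  -- dist v w = least j with within j v w (searching j = 0 .. n-1;
  -- in a connected graph on n vertices the distance is ≤ n-1, so the
  -- fallback value n is never used for connected graphs)
  distFrom : ℕ → ℕ → Fin n → Fin n → ℕ
  distFrom j zero     v w = j
  distFrom j (suc f) v w = if within j v w then j else distFrom (suc j) f v w

  dist : Fin n → Fin n → ℕ
  dist v w = distFrom 0 n v w

  ecc : Fin n → ℕ
  ecc v = foldr (λ w m → dist v w ⊔ m) 0 vertices

  ξᶜ : ℕ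
  ξᶜ = sum (map (λ v → deg v * ecc v) vertices)

-- Vertex i (as a natural number < n):
--   i = 0 .. D        : path vertex u_i
--   i = D+1 .. n-1    : clique vertex; the k clique vertices
--                       D+1 .. D+k are the ones joined to u_2.

edgeℕ : ℕ → ℕ → ℕ → ℕ → Bool
edgeℕ D k a b =
     ((a <ᵇ suc D) ∧ (b ≡ᵇ suc a) ∧ (b <ᵇ suc D))
  ∨
     (not (a <ᵇ suc D) ∧ not (b <ᵇ suc D) ∧ not (a ≡ᵇ b))
  ∨
     (((a ≡ᵇ 0) ∨ (a ≡ᵇ 1)) ∧ not (b <ᵇ suc D))
  ∨
     ((a ≡ᵇ 2) ∧ not (b <ᵇ suc D) ∧ (b <ᵇ (suc D + k)))

Gndk : (n D k : ℕ) → Graph n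
Gndk n D k x y = edgeℕ D k (toℕ x) (toℕ y) ∨ edgeℕ D k (toℕ y) (toℕ x)

sumMax : ℕ → ℕ
sumMax D = sum (map (λ i → i ⊔ (D ∸ i)) (upTo D))

-- Distances in G_{n,D,k} are explicit: |i - j| between path vertices u_i and u_j, at most 1
-- inside the clique, and from u_i to a clique vertex 1 when i ≤ 1 and otherwise i - 1 or i,
-- according as the clique vertex is or is not joined to u_2.  This candidate is the graph
-- distance because it vanishes only on the diagonal, changes by at most one along an edge, and
-- can always be decreased by one along some edge.  Reading off degrees and eccentricities
-- vertex by vertex turns ξᶜ into a closed form, and the stated formula is a ring identity in
-- D, the clique size, k, max{2, D-2} and Σ_{3 ≤ i < D} max{i, D-i}.
module Submission where

open import Defs

-- Kept in its own module so that ℕ's _+_ and _*_ are not in scope next to ℤ's in lemma2.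
module _ where

  open import Data.Bool using (Bool; true; false; T; _∧_; _∨_; not; if_then_else_)
  open import Data.Bool.Properties using (T-∨; T-∧; T-≡; T-not-≡)
  open import Data.Empty using (⊥-elim)
  open import Data.Fin using (Fin; toℕ; fromℕ<)
  open import Data.Fin.Properties using (toℕ-injective; toℕ<n; toℕ-fromℕ<)
  open import Data.List using ([]; _∷_; foldr; map; tabulate; applyUpTo)
  open import Data.List.Properties using (foldr-map)
  open import Data.List.Membership.Propositional using (_∈_)
  open import Data.List.Membership.Propositional.Properties using (∈-allFin)
  open import Data.List.Relation.Unary.Any using (here; there)
  open import Data.Nat
  open import Data.Nat.Properties
  open import Data.Nat.ListAction using (sum)
  open import Data.Nat.Tactic.RingSolver using (solve-∀)
  open import Data.Product using (∃-syntax; _×_; _,_)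
  open import Data.Sum using (_⊎_; inj₁; inj₂; [_,_])
  open import Algebra.Properties.CommutativeSemigroup +-commutativeSemigroup using (interchange)
  open import Function using (_∘_; id)
  open import Function.Bundles using (_⇔_; mk⇔; Equivalence)
  open Equivalence using (to; from)
  open import Function.Construct.Composition using (_⇔-∘_)
  open import Function.Construct.Symmetry using (⇔-sym)
  open import Data.Product.Function.NonDependent.Propositional using (_×-⇔_)
  open import Data.Sum.Function.Propositional using (_⊎-⇔_)
  open import Relation.Binary.PropositionalEquality
    using (_≡_; _≢_; refl; sym; trans; cong; cong₂; subst; subst₂; ≢-sym; module ≡-Reasoning)
  open import Relation.Nullary using (¬_; yes; no)

  T-≡ᵇ : ∀ {a b} → T (a ≡ᵇ b) ⇔ a ≡ b
  T-≡ᵇ {a} {b} = mk⇔ (≡ᵇ⇒≡ a b) (≡⇒≡ᵇ a b)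

  T-<ᵇ : ∀ {a b} → T (a <ᵇ b) ⇔ a < b
  T-<ᵇ {a} {b} = mk⇔ (<ᵇ⇒< a b) <⇒<ᵇ

  T-not : ∀ {b} → T (not b) ⇔ (¬ T b)
  T-not {true}  = mk⇔ (λ ()) (λ ¬t → ¬t _)
  T-not {false} = mk⇔ (λ _ ()) (λ _ → _)

  T-not-<ᵇ : ∀ {a b} → T (not (a <ᵇ b)) ⇔ b ≤ a
  T-not-<ᵇ = mk⇔ (λ t → ≮⇒≥ (to T-not t ∘ from T-<ᵇ)) (λ b≤a → from T-not (≤⇒≯ b≤a ∘ to T-<ᵇ))

  T-not-≡ᵇ : ∀ {a b} → T (not (a ≡ᵇ b)) ⇔ a ≢ b
  T-not-≡ᵇ = mk⇔ (λ t → to T-not t ∘ from T-≡ᵇ) (λ a≢b → from T-not (a≢b ∘ to T-≡ᵇ))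

  infixr 6 _∧-⇔_
  infixr 5 _∨-⇔_

  _∧-⇔_ : ∀ {x y} {A B : Set} → T x ⇔ A → T y ⇔ B → T (x ∧ y) ⇔ (A × B)
  p ∧-⇔ q = (p ×-⇔ q) ⇔-∘ T-∧

  _∨-⇔_ : ∀ {x y} {A B : Set} → T x ⇔ A → T y ⇔ B → T (x ∨ y) ⇔ (A ⊎ B)
  p ∨-⇔ q = (p ⊎-⇔ q) ⇔-∘ T-∨

  ind : Bool → ℕ
  ind b = if b then 1 else 0

  ind-true : ∀ {b} → T b → ind b ≡ 1
  ind-true {true} _ = refl

  ind-false : ∀ {b} → ¬ T b → ind b ≡ 0
  ind-false {true} ¬b = ⊥-elim (¬b _)
  ind-false {false} _ = refl

  ind-cong : ∀ {a b} → (T a ⇔ T b) → ind a ≡ ind b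
  ind-cong {true}  {true}  _ = refl
  ind-cong {true}  {false} a⇔b = ⊥-elim (to a⇔b _)
  ind-cong {false} {true}  a⇔b = ⊥-elim (from a⇔b _)
  ind-cong {false} {false} _ = refl

  ind-∨ : ∀ a b → ¬ (T a × T b) → ind (a ∨ b) ≡ ind a + ind b
  ind-∨ true  true  disjoint = ⊥-elim (disjoint (_ , _))
  ind-∨ true  false _ = refl
  ind-∨ false b     _ = refl

  ind-not : ∀ b → ind (not b) + ind b ≡ 1
  ind-not true  = refl
  ind-not false = refl

  ind≤1 : ∀ b → ind b ≤ 1
  ind≤1 true  = ≤-refl
  ind≤1 false = z≤n

  ∣m-1+n∣≤1+∣m-n∣ : ∀ m n → ∣ m - suc n ∣ ≤ suc ∣ m - n ∣
  ∣m-1+n∣≤1+∣m-n∣ zero    n       = ≤-refl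
  ∣m-1+n∣≤1+∣m-n∣ (suc m) zero    = ≤-trans (≤-reflexive (∣-∣-identityʳ m)) (m≤n⇒m≤1+n (n≤1+n m))
  ∣m-1+n∣≤1+∣m-n∣ (suc m) (suc n) = ∣m-1+n∣≤1+∣m-n∣ m n

  ∣m-n∣≤1+∣m-1+n∣ : ∀ m n → ∣ m - n ∣ ≤ suc ∣ m - suc n ∣
  ∣m-n∣≤1+∣m-1+n∣ zero    n       = m≤n⇒m≤1+n (n≤1+n n)
  ∣m-n∣≤1+∣m-1+n∣ (suc m) zero    = s≤s (≤-reflexive (sym (∣-∣-identityʳ m)))
  ∣m-n∣≤1+∣m-1+n∣ (suc m) (suc n) = ∣m-n∣≤1+∣m-1+n∣ m n

  ∣m-n∣≡1+t : ∀ m n {t} → ∣ m - n ∣ ≡ suc t →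
              (∃[ n′ ] n ≡ suc n′ × ∣ m - n′ ∣ ≡ t) ⊎ (n < m × ∣ m - suc n ∣ ≡ t)
  ∣m-n∣≡1+t zero    (suc n) eq = inj₁ (n , refl , suc-injective eq)
  ∣m-n∣≡1+t (suc m) zero    eq = inj₂ (z<s , trans (∣-∣-identityʳ m) (suc-injective eq))
  ∣m-n∣≡1+t (suc m) (suc n) eq with ∣m-n∣≡1+t m n eq
  ... | inj₁ (n′ , refl , eq′) = inj₁ (suc n′ , refl , eq′)
  ... | inj₂ (n<m , eq′)       = inj₂ (s<s n<m , eq′)

  1+m+n∸m∸1≡n : ∀ m n → suc (m + n) ∸ m ∸ 1 ≡ n
  1+m+n∸m∸1≡n m n = cong (_∸ 1) (trans (cong (_∸ m) (sym (+-suc m n))) (m+n∸m≡n m (suc n)))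

  ∑< : ℕ → (ℕ → ℕ) → ℕ
  ∑< zero    f = 0
  ∑< (suc n) f = f 0 + ∑< n (f ∘ suc)

  syntax ∑< n (λ i → e) = ∑[ i < n ] e

  ∑-cong : ∀ n {f g} → (∀ i → i < n → f i ≡ g i) → ∑< n f ≡ ∑< n g
  ∑-cong zero    _  = refl
  ∑-cong (suc n) eq = cong₂ _+_ (eq 0 z<s) (∑-cong n (λ i i<n → eq (suc i) (s<s i<n)))

  ∑-split : ∀ a b f → ∑< (a + b) f ≡ ∑< a f + ∑[ i < b ] f (a + i)
  ∑-split zero    b f = refl
  ∑-split (suc a) b f = trans (cong (f 0 +_) (∑-split a b (f ∘ suc))) (sym (+-assoc (f 0) _ _))

  ∑-last : ∀ n f → ∑< (suc n) f ≡ ∑< n f + f n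
  ∑-last n f = begin
    ∑< (suc n) f             ≡⟨ cong (λ m → ∑< m f) (+-comm 1 n) ⟩
    ∑< (n + 1) f             ≡⟨ ∑-split n 1 f ⟩
    ∑< n f + (f (n + 0) + 0) ≡⟨ cong (λ x → ∑< n f + (f x + 0)) (+-identityʳ n) ⟩
    ∑< n f + (f n + 0)       ≡⟨ cong (∑< n f +_) (+-identityʳ (f n)) ⟩
    ∑< n f + f n             ∎
    where open ≡-Reasoning

  ∑-distrib-+ : ∀ n f g → ∑[ i < n ] (f i + g i) ≡ ∑< n f + ∑< n g
  ∑-distrib-+ zero    f g = refl
  ∑-distrib-+ (suc n) f g = trans (cong (f 0 + g 0 +_) (∑-distrib-+ n (f ∘ suc) (g ∘ suc)))
                                  (interchange (f 0) (g 0) (∑< n (f ∘ suc)) (∑< n (g ∘ suc)))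

  ∑-const : ∀ n c → ∑[ _ < n ] c ≡ n * c
  ∑-const zero    c = refl
  ∑-const (suc n) c = cong (c +_) (∑-const n c)

  ∑-ones : ∀ n → ∑[ _ < n ] 1 ≡ n
  ∑-ones n = trans (∑-const n 1) (*-identityʳ n)

  ∑-zero : ∀ n → ∑[ _ < n ] 0 ≡ 0
  ∑-zero n = trans (∑-const n 0) (*-zeroʳ n)

  ∑-*ˡ : ∀ n c f → ∑[ i < n ] (c * f i) ≡ c * ∑< n f
  ∑-*ˡ zero    c f = sym (*-zeroʳ c)
  ∑-*ˡ (suc n) c f = trans (cong (c * f 0 +_) (∑-*ˡ n c (f ∘ suc))) (sym (*-distribˡ-+ c (f 0) _))

  ∑-ind-≡ᵇ : ∀ n t → ∑[ i < n ] ind (i ≡ᵇ t) ≡ ind (t <ᵇ n)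
  ∑-ind-≡ᵇ zero    t       = refl
  ∑-ind-≡ᵇ (suc n) zero    = cong suc (∑-zero n)
  ∑-ind-≡ᵇ (suc n) (suc t) = ∑-ind-≡ᵇ n t

  ∑-if-<ᵇ : ∀ k r a b → ∑[ i < k + r ] (if i <ᵇ k then a else b) ≡ k * a + r * b
  ∑-if-<ᵇ zero    r a b = ∑-const r b
  ∑-if-<ᵇ (suc k) r a b = trans (cong (a +_) (∑-if-<ᵇ k r a b)) (sym (+-assoc a _ _))

  ∑-ind-<ᵇ : ∀ k r → ∑[ i < k + r ] ind (i <ᵇ k) ≡ k
  ∑-ind-<ᵇ k r = begin
    ∑[ i < k + r ] ind (i <ᵇ k) ≡⟨ ∑-if-<ᵇ k r 1 0 ⟩
    k * 1 + r * 0               ≡⟨ cong₂ _+_ (*-identityʳ k) (*-zeroʳ r) ⟩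
    k + 0                       ≡⟨ +-identityʳ k ⟩
    k                           ∎
    where open ≡-Reasoning

  ∑-ind-≢ : ∀ {n t} → t < n → ∑[ i < n ] ind (not (i ≡ᵇ t)) + 1 ≡ n
  ∑-ind-≢ {n} {t} t<n = begin
    ∑[ i < n ] ind (not (i ≡ᵇ t)) + 1
      ≡⟨ cong (∑[ i < n ] ind (not (i ≡ᵇ t)) +_) (sym (trans (∑-ind-≡ᵇ n t) (ind-true (from T-<ᵇ t<n)))) ⟩
    ∑[ i < n ] ind (not (i ≡ᵇ t)) + ∑[ i < n ] ind (i ≡ᵇ t)    ≡⟨ sym (∑-distrib-+ n _ _) ⟩
    ∑[ i < n ] (ind (not (i ≡ᵇ t)) + ind (i ≡ᵇ t))             ≡⟨ ∑-cong n (λ i _ → ind-not (i ≡ᵇ t)) ⟩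
    ∑[ _ < n ] 1                                               ≡⟨ ∑-ones n ⟩
    n                                                          ∎
    where open ≡-Reasoning

  ∑-applyUpTo : ∀ (f h : ℕ → ℕ) n → sum (map f (applyUpTo h n)) ≡ ∑[ i < n ] f (h i)
  ∑-applyUpTo f h zero    = refl
  ∑-applyUpTo f h (suc n) = cong (f (h 0) +_) (∑-applyUpTo f (h ∘ suc) n)

  foldr-+-tabulate : ∀ {n m} (g : Fin n → Fin m) (F : Fin m → ℕ) (f : ℕ → ℕ) →
                     (∀ i → F (g i) ≡ f (toℕ i)) → foldr (λ x s → F x + s) 0 (tabulate g) ≡ ∑< n f
  foldr-+-tabulate {zero}  g F f eq = refl
  foldr-+-tabulate {suc n} g F f eq =
    cong₂ _+_ (eq Fin.zero) (foldr-+-tabulate (g ∘ Fin.suc) F (f ∘ suc) (eq ∘ Fin.suc))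

  module _ {A : Set} (f : A → ℕ) where

    foldr-⊔-lub : ∀ {M} xs → (∀ x → f x ≤ M) → foldr (λ x r → f x ⊔ r) 0 xs ≤ M
    foldr-⊔-lub []       _   = z≤n
    foldr-⊔-lub (x ∷ xs) f≤M = ⊔-lub (f≤M x) (foldr-⊔-lub xs f≤M)

    foldr-⊔-ub : ∀ {x} xs → x ∈ xs → f x ≤ foldr (λ x r → f x ⊔ r) 0 xs
    foldr-⊔-ub (y ∷ xs) (here refl) = m≤m⊔n (f y) _
    foldr-⊔-ub (y ∷ xs) (there x∈) = ≤-trans (foldr-⊔-ub xs x∈) (m≤n⊔m (f y) _)

  module _ {A : Set} (p : A → Bool) where

    foldr-∨-witness : ∀ xs → T (foldr (λ x b → p x ∨ b) false xs) → ∃[ x ] T (p x)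
    foldr-∨-witness (x ∷ xs) t with to (T-∨ {p x}) t
    ... | inj₁ px = x , px
    ... | inj₂ t′ = foldr-∨-witness xs t′

    foldr-∨-intro : ∀ {x} xs → x ∈ xs → T (p x) → T (foldr (λ x b → p x ∨ b) false xs)
    foldr-∨-intro (y ∷ xs) (here refl) px = from T-∨ (inj₁ px)
    foldr-∨-intro (y ∷ xs) (there x∈) px = from (T-∨ {p y}) (inj₂ (foldr-∨-intro xs x∈ px))

  module _ {n : ℕ} (G : Graph n) where

    T-== : ∀ {v w} → T (_==_ G v w) ⇔ v ≡ w
    T-== = mk⇔ (toℕ-injective ∘ to T-≡ᵇ) (from T-≡ᵇ ∘ cong toℕ)

    deg≡∑ : ∀ v (f : ℕ → ℕ) → (∀ w → ind (G v w) ≡ f (toℕ w)) → deg G v ≡ ∑< n f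
    deg≡∑ v = foldr-+-tabulate id (ind ∘ G v)

    ξᶜ≡∑ : (f : ℕ → ℕ) → (∀ v → deg G v * ecc G v ≡ f (toℕ v)) → ξᶜ G ≡ ∑< n f
    ξᶜ≡∑ f eq = trans (foldr-map _+_ (λ v → deg G v * ecc G v) 0 (allFin n)) (foldr-+-tabulate id _ f eq)

    ecc≡ : ∀ v {M} → (∀ w → dist G v w ≤ M) → (∃[ w ] dist G v w ≡ M) → ecc G v ≡ M
    ecc≡ v {M} bound (w , attained) = ≤-antisym
      (foldr-⊔-lub (dist G v) (allFin n) bound)
      (subst (_≤ ecc G v) attained (foldr-⊔-ub (dist G v) (allFin n) (∈-allFin w)))

    module DistanceCharacterisation
      (d : Fin n → Fin n → ℕ)
      (d-self : ∀ v → d v v ≡ 0)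
      (d≡0⇒≡ : ∀ {v w} → d v w ≡ 0 → v ≡ w)
      (d-edge : ∀ v {u w} → T (G u w) → d v w ≤ suc (d v u))
      (d-pred : ∀ v w {t} → d v w ≡ suc t → ∃[ u ] T (G u w) × d v u ≡ t)
      where

      within⇒≤ : ∀ j v w → T (within G j v w) → d v w ≤ j
      within⇒≤ zero    v w t = ≤-reflexive (trans (cong (d v) (sym (to T-== t))) (d-self v))
      within⇒≤ (suc j) v w t with to (T-∨ {within G j v w}) t
      ... | inj₁ near = m≤n⇒m≤1+n (within⇒≤ j v w near)
      ... | inj₂ via with foldr-∨-witness (λ u → within G j v u ∧ G u w) (allFin n) via
      ...   | u , tu with to (T-∧ {within G j v u}) tu
      ...     | near-u , edge = ≤-trans (d-edge v edge) (s≤s (within⇒≤ j v u near-u))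

      ≤⇒within : ∀ j v w → d v w ≤ j → T (within G j v w)
      ≤⇒within zero    v w d≤0 = from T-== (d≡0⇒≡ (n≤0⇒n≡0 d≤0))
      ≤⇒within (suc j) v w d≤1+j with m≤n⇒m<n∨m≡n d≤1+j
      ... | inj₁ d<1+j = from T-∨ (inj₁ (≤⇒within j v w (≤-pred d<1+j)))
      ... | inj₂ d≡1+j with d-pred v w d≡1+j
      ...   | u , edge , du≡j = from (T-∨ {within G j v w}) (inj₂
                (foldr-∨-intro (λ u → within G j v u ∧ G u w) (allFin n) (∈-allFin u)
                  (from T-∧ (≤⇒within j v u (≤-reflexive du≡j) , edge))))

      distFrom≡ : ∀ f j v w → j ≤ d v w → d v w < j + f → distFrom G j f v w ≡ d v w
      distFrom≡ zero    j v w j≤d d<j = ⊥-elim (<⇒≱ (subst (d v w <_) (+-identityʳ j) d<j) j≤d)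
      distFrom≡ (suc f) j v w j≤d d<j+f with within G j v w in eq
      ... | true  = ≤-antisym j≤d (within⇒≤ j v w (subst T (sym eq) _))
      ... | false = distFrom≡ f (suc j) v w (≰⇒> (λ d≤j → subst T eq (≤⇒within j v w d≤j)))
                                             (subst (d v w <_) (+-suc j f) d<j+f)

      dist≡ : (∀ v w → d v w < n) → ∀ v w → dist G v w ≡ d v w
      dist≡ d<n v w = distFrom≡ n 0 v w z≤n (d<n v w)

  module Model (e k r : ℕ) where

    D m N : ℕ
    D = 3 + e
    m = k + r
    N = suc D + m

    data Vertex : Set where
      path   : ℕ → Vertex
      clique : ℕ → Vertex

    label : Vertex → ℕ
    label (path i)   = i
    label (clique c) = suc D + c

    Valid : Vertex → Set
    Valid (path i)   = i ≤ D
    Valid (clique c) = c < m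

    data Arc : Vertex → Vertex → Set where
      path-step     : ∀ {i}   → Arc (path i) (path (suc i))
      clique-clique : ∀ {a b} → a ≢ b → Arc (clique a) (clique b)
      hub₀          : ∀ {a}   → Arc (path 0) (clique a)
      hub₁          : ∀ {a}   → Arc (path 1) (clique a)
      spoke         : ∀ {a}   → a < k → Arc (path 2) (clique a)

    Adj : Vertex → Vertex → Set
    Adj x y = Arc x y ⊎ Arc y x

    edge : ℕ → ℕ → Bool
    edge a b = edgeℕ D k a b ∨ edgeℕ D k b a

    LabelArc : ℕ → ℕ → Set
    LabelArc a b = (a < suc D × b ≡ suc a × b < suc D)
                 ⊎ (suc D ≤ a × suc D ≤ b × a ≢ b)
                 ⊎ ((a ≡ 0 ⊎ a ≡ 1) × suc D ≤ b)
                 ⊎ (a ≡ 2 × suc D ≤ b × b < suc D + k)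

    edgeℕ⇔LabelArc : ∀ {a b} → T (edgeℕ D k a b) ⇔ LabelArc a b
    edgeℕ⇔LabelArc = (T-<ᵇ ∧-⇔ T-≡ᵇ ∧-⇔ T-<ᵇ)
                 ∨-⇔ (T-not-<ᵇ ∧-⇔ T-not-<ᵇ ∧-⇔ T-not-≡ᵇ)
                 ∨-⇔ ((T-≡ᵇ ∨-⇔ T-≡ᵇ) ∧-⇔ T-not-<ᵇ)
                 ∨-⇔ (T-≡ᵇ ∧-⇔ T-not-<ᵇ ∧-⇔ T-<ᵇ)

    clique-label : ∀ c → suc D ≤ label (clique c)
    clique-label c = m≤m+n (suc D) c

    LabelArc⇒Arc : ∀ x y → Valid x → Valid y → LabelArc (label x) (label y) → Arc x y
    LabelArc⇒Arc (path i)   (path j)   _  _  (inj₁ (_ , refl , _))               = path-step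
    LabelArc⇒Arc (path i)   (path j)   vx _  (inj₂ (inj₁ (D<i , _)))             = ⊥-elim (≤⇒≯ vx D<i)
    LabelArc⇒Arc (path i)   (path j)   _  vy (inj₂ (inj₂ (inj₁ (_ , D<j))))      = ⊥-elim (≤⇒≯ vy D<j)
    LabelArc⇒Arc (path i)   (path j)   _  vy (inj₂ (inj₂ (inj₂ (_ , D<j , _))))  = ⊥-elim (≤⇒≯ vy D<j)
    LabelArc⇒Arc (path i)   (clique c) _  _  (inj₁ (_ , _ , c<))                 = ⊥-elim (m+n≮m (suc D) c c<)
    LabelArc⇒Arc (path i)   (clique c) vx _  (inj₂ (inj₁ (D<i , _)))             = ⊥-elim (≤⇒≯ vx D<i)
    LabelArc⇒Arc (path _)   (clique c) _  _  (inj₂ (inj₂ (inj₁ (inj₁ refl , _)))) = hub₀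
    LabelArc⇒Arc (path _)   (clique c) _  _  (inj₂ (inj₂ (inj₁ (inj₂ refl , _)))) = hub₁
    LabelArc⇒Arc (path _)   (clique c) _  _  (inj₂ (inj₂ (inj₂ (refl , _ , c<)))) = spoke (+-cancelˡ-< (suc D) c k c<)
    LabelArc⇒Arc (clique c) (path j)   _  _  (inj₁ (c< , _))                     = ⊥-elim (m+n≮m (suc D) c c<)
    LabelArc⇒Arc (clique c) (path j)   _  vy (inj₂ (inj₁ (_ , D<j , _)))         = ⊥-elim (≤⇒≯ vy D<j)
    LabelArc⇒Arc (clique c) (path j)   _  _  (inj₂ (inj₂ (inj₁ (inj₁ () , _))))
    LabelArc⇒Arc (clique c) (path j)   _  _  (inj₂ (inj₂ (inj₁ (inj₂ () , _))))
    LabelArc⇒Arc (clique c) (path j)   _  _  (inj₂ (inj₂ (inj₂ (() , _))))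
    LabelArc⇒Arc (clique a) (clique b) _  _  (inj₁ (a< , _))                     = ⊥-elim (m+n≮m (suc D) a a<)
    LabelArc⇒Arc (clique a) (clique b) _  _  (inj₂ (inj₁ (_ , _ , a≢b)))         = clique-clique (a≢b ∘ cong (suc D +_))
    LabelArc⇒Arc (clique a) (clique b) _  _  (inj₂ (inj₂ (inj₁ (inj₁ () , _))))
    LabelArc⇒Arc (clique a) (clique b) _  _  (inj₂ (inj₂ (inj₁ (inj₂ () , _))))
    LabelArc⇒Arc (clique a) (clique b) _  _  (inj₂ (inj₂ (inj₂ (() , _))))

    Arc⇒LabelArc : ∀ {x y} → Valid y → Arc x y → LabelArc (label x) (label y)
    Arc⇒LabelArc vy path-step                 = inj₁ (s≤s (<⇒≤ vy) , refl , s≤s vy)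
    Arc⇒LabelArc _  (clique-clique {a} {b} a≢b) =
      inj₂ (inj₁ (clique-label a , clique-label b , a≢b ∘ +-cancelˡ-≡ (suc D) a b))
    Arc⇒LabelArc _  (hub₀ {a})                = inj₂ (inj₂ (inj₁ (inj₁ refl , clique-label a)))
    Arc⇒LabelArc _  (hub₁ {a})                = inj₂ (inj₂ (inj₁ (inj₂ refl , clique-label a)))
    Arc⇒LabelArc _  (spoke {a} a<k)           =
      inj₂ (inj₂ (inj₂ (refl , clique-label a , +-monoʳ-< (suc D) a<k)))

    edge⇔Adj : ∀ {x y} → Valid x → Valid y → T (edge (label x) (label y)) ⇔ Adj x y
    edge⇔Adj vx vy = arc⇔ vx vy ∨-⇔ arc⇔ vy vx
      where
      arc⇔ : ∀ {x y} → Valid x → Valid y → T (edgeℕ D k (label x) (label y)) ⇔ Arc x y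
      arc⇔ {x} {y} vx vy = mk⇔ (LabelArc⇒Arc x y vx vy) (Arc⇒LabelArc vy) ⇔-∘ edgeℕ⇔LabelArc

    hubᵇ : ℕ → ℕ → Bool
    hubᵇ 0                   _ = true
    hubᵇ 1                   _ = true
    hubᵇ 2                   c = c <ᵇ k
    hubᵇ (suc (suc (suc _))) _ = false

    adjᵇ : Vertex → Vertex → Bool
    adjᵇ (path i)   (path j)   = (j ≡ᵇ suc i) ∨ (suc j ≡ᵇ i)
    adjᵇ (path i)   (clique c) = hubᵇ i c
    adjᵇ (clique c) (path i)   = hubᵇ i c
    adjᵇ (clique a) (clique b) = not (b ≡ᵇ a)

    T-hubᵇ : ∀ i c → T (hubᵇ i c) ⇔ Arc (path i) (clique c)
    T-hubᵇ 0                   c = mk⇔ (λ _ → hub₀) (λ _ → _)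
    T-hubᵇ 1                   c = mk⇔ (λ _ → hub₁) (λ _ → _)
    T-hubᵇ 2                   c = mk⇔ (spoke ∘ to T-<ᵇ) (λ { (spoke c<k) → from T-<ᵇ c<k })
    T-hubᵇ (suc (suc (suc _))) c = mk⇔ (λ ()) (λ ())

    T-adjᵇ : ∀ x y → T (adjᵇ x y) ⇔ Adj x y
    T-adjᵇ (path i)   (path j)   = mk⇔ adjacent step-of ⇔-∘ (T-≡ᵇ ∨-⇔ T-≡ᵇ)
      where
      adjacent : (j ≡ suc i) ⊎ (suc j ≡ i) → Adj (path i) (path j)
      adjacent (inj₁ refl) = inj₁ path-step
      adjacent (inj₂ refl) = inj₂ path-step
      step-of : Adj (path i) (path j) → (j ≡ suc i) ⊎ (suc j ≡ i)
      step-of (inj₁ path-step) = inj₁ refl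
      step-of (inj₂ path-step) = inj₂ refl
    T-adjᵇ (path i)   (clique c) = mk⇔ inj₁ [ id , (λ ()) ] ⇔-∘ T-hubᵇ i c
    T-adjᵇ (clique c) (path i)   = mk⇔ inj₂ [ (λ ()) , id ] ⇔-∘ T-hubᵇ i c
    T-adjᵇ (clique a) (clique b) = mk⇔ (inj₁ ∘ clique-clique) adj⇒≢ ⇔-∘ (≢-sym-⇔ ⇔-∘ T-not-≡ᵇ)
      where
      adj⇒≢ : Adj (clique a) (clique b) → a ≢ b
      adj⇒≢ (inj₁ (clique-clique a≢b)) = a≢b
      adj⇒≢ (inj₂ (clique-clique b≢a)) = ≢-sym b≢a
      ≢-sym-⇔ : b ≢ a ⇔ a ≢ b
      ≢-sym-⇔ = mk⇔ ≢-sym ≢-sym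

    ind-edge : ∀ {x y} → Valid x → Valid y → ind (edge (label x) (label y)) ≡ ind (adjᵇ x y)
    ind-edge {x} {y} vx vy = ind-cong (⇔-sym (T-adjᵇ x y) ⇔-∘ edge⇔Adj vx vy)

    vertexOf : ℕ → Vertex
    vertexOf a with a ≤? D
    ... | yes _ = path a
    ... | no  _ = clique (a ∸ suc D)

    label-vertexOf : ∀ a → label (vertexOf a) ≡ a
    label-vertexOf a with a ≤? D
    ... | yes _   = refl
    ... | no  a≰D = m+[n∸m]≡n (≰⇒> a≰D)

    valid-vertexOf : ∀ {a} → a < N → Valid (vertexOf a)
    valid-vertexOf {a} a<N with a ≤? D
    ... | yes a≤D = a≤D
    ... | no  a≰D = +-cancelˡ-< (suc D) (a ∸ suc D) m (subst (_< N) (sym (m+[n∸m]≡n (≰⇒> a≰D))) a<N)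

    vertexOf-label : ∀ x → Valid x → vertexOf (label x) ≡ x
    vertexOf-label (path i) vx with i ≤? D
    ... | yes _   = refl
    ... | no  i≰D = ⊥-elim (i≰D vx)
    vertexOf-label (clique c) _ with suc D + c ≤? D
    ... | yes c≤D = ⊥-elim (m+n≮m (suc D) c (s≤s c≤D))
    ... | no  _   = cong clique (m+n∸m≡n (suc D) c)

    label<N : ∀ x → Valid x → label x < N
    label<N (path i)   vx = ≤-trans (s≤s vx) (m≤m+n (suc D) m)
    label<N (clique c) vx = +-monoʳ-< (suc D) vx

    vertex : Fin N → Vertex
    vertex v = vertexOf (toℕ v)

    valid-vertex : ∀ v → Valid (vertex v)
    valid-vertex v = valid-vertexOf (toℕ<n v)

    label-vertex : ∀ v → label (vertex v) ≡ toℕ v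
    label-vertex v = label-vertexOf (toℕ v)

    index : ∀ x → Valid x → Fin N
    index x vx = fromℕ< (label<N x vx)

    vertex-index : ∀ x vx → vertex (index x vx) ≡ x
    vertex-index x vx = trans (cong vertexOf (toℕ-fromℕ< (label<N x vx))) (vertexOf-label x vx)

    vertex-injective : ∀ {v w} → vertex v ≡ vertex w → v ≡ w
    vertex-injective {v} {w} eq = toℕ-injective (trans (sym (label-vertex v)) (trans (cong label eq) (label-vertex w)))

    G : Graph N
    G = Gndk N D k

    T-G : ∀ v w → T (G v w) ⇔ Adj (vertex v) (vertex w)
    T-G v w = subst₂ (λ a b → T (edge a b) ⇔ Adj (vertex v) (vertex w)) (label-vertex v) (label-vertex w)
                     (edge⇔Adj (valid-vertex v) (valid-vertex w))

    -- u_{2+j} reaches a clique vertex c through u_2 when c < k, and through u_1 otherwise.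
    δpc : ℕ → ℕ → ℕ
    δpc 0             _ = 1
    δpc 1             _ = 1
    δpc (suc (suc j)) c = suc j + ind (not (c <ᵇ k))

    δ : Vertex → Vertex → ℕ
    δ (path i)   (path j)   = ∣ i - j ∣
    δ (path i)   (clique c) = δpc i c
    δ (clique c) (path i)   = δpc i c
    δ (clique a) (clique b) = ind (not (b ≡ᵇ a))

    δpc-pos : ∀ i c → 1 ≤ δpc i c
    δpc-pos 0             _ = ≤-refl
    δpc-pos 1             _ = ≤-refl
    δpc-pos (suc (suc j)) _ = s≤s z≤n

    δpc-lower : ∀ j c → suc j ≤ δpc (suc (suc j)) c
    δpc-lower j c = m≤m+n (suc j) _

    δpc-upper : ∀ j c → δpc (suc (suc j)) c ≤ suc (suc j)
    δpc-upper j c = ≤-trans (+-monoʳ-≤ (suc j) (ind≤1 _)) (≤-reflexive (+-comm (suc j) 1))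

    δpc-spoke : ∀ j {c} → c < k → δpc (suc (suc j)) c ≡ suc j
    δpc-spoke j c<k = trans (cong (λ b → suc j + ind (not b)) (to T-≡ (from T-<ᵇ c<k))) (+-identityʳ (suc j))

    δpc-step : ∀ i c → δpc i c ≤ δpc (suc i) c
    δpc-step 0             _ = ≤-refl
    δpc-step 1             c = δpc-pos 2 c
    δpc-step (suc (suc j)) _ = n≤1+n _

    δpc-step≤1 : ∀ i c → δpc (suc i) c ≤ suc (δpc i c)
    δpc-step≤1 0             _ = s≤s z≤n
    δpc-step≤1 1             c = δpc-upper 0 c
    δpc-step≤1 (suc (suc j)) _ = ≤-refl

    δpc-mono : ∀ c {i j} → i ≤ j → δpc i c ≤ δpc j c
    δpc-mono c {j = zero}  z≤n = ≤-refl
    δpc-mono c {j = suc j} i≤1+j with m≤n⇒m<n∨m≡n i≤1+j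
    ... | inj₁ i<1+j = ≤-trans (δpc-mono c (≤-pred i<1+j)) (δpc-step j c)
    ... | inj₂ refl  = ≤-refl

    δpc-≤1+ : ∀ i c → δpc i c ≤ suc i
    δpc-≤1+ 0             _ = ≤-refl
    δpc-≤1+ 1             _ = s≤s z≤n
    δpc-≤1+ (suc (suc j)) c = m≤n⇒m≤1+n (δpc-upper j c)

    ≤1+δpc : ∀ i c → i ≤ suc (δpc i c)
    ≤1+δpc 0             _ = z≤n
    ≤1+δpc 1             _ = s≤s z≤n
    ≤1+δpc (suc (suc j)) c = s≤s (δpc-lower j c)

    δpc-clique : ∀ i a b → δpc i b ≤ suc (δpc i a)
    δpc-clique 0             _ _ = s≤s z≤n
    δpc-clique 1             _ _ = s≤s z≤n
    δpc-clique (suc (suc j)) a b = ≤-trans (δpc-upper j b) (s≤s (δpc-lower j a))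

    δ-clique≤1 : ∀ a b → δ (clique a) (clique b) ≤ 1
    δ-clique≤1 a b = ind≤1 (not (b ≡ᵇ a))

    δ-self : ∀ x → δ x x ≡ 0
    δ-self (path i)   = ∣n-n∣≡0 i
    δ-self (clique c) = cong (ind ∘ not) (to T-≡ (from T-≡ᵇ (refl {x = c})))

    δ≡0⇒≡ : ∀ x y → δ x y ≡ 0 → x ≡ y
    δ≡0⇒≡ (path i)   (path j)   eq = cong path (∣m-n∣≡0⇒m≡n eq)
    δ≡0⇒≡ (path i)   (clique c) eq = ⊥-elim (1+n≰n (subst (1 ≤_) eq (δpc-pos i c)))
    δ≡0⇒≡ (clique c) (path i)   eq = ⊥-elim (1+n≰n (subst (1 ≤_) eq (δpc-pos i c)))
    δ≡0⇒≡ (clique a) (clique b) eq with b ≡ᵇ a in b≡a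
    ... | true  = cong clique (sym (to T-≡ᵇ (from T-≡ b≡a)))

    δ-arc-head : ∀ x {y z} → Arc y z → δ x z ≤ suc (δ x y)
    δ-arc-head (path a)   (path-step {i})   = ∣m-1+n∣≤1+∣m-n∣ a i
    δ-arc-head (clique c) (path-step {i})   = δpc-step≤1 i c
    δ-arc-head (path a)   (clique-clique {a = b} {c} _) = δpc-clique a b c
    δ-arc-head (path a)   (hub₀ {c})        = subst (δpc a c ≤_) (cong suc (sym (∣-∣-identityʳ a))) (δpc-≤1+ a c)
    δ-arc-head (path 0)   hub₁              = s≤s z≤n
    δ-arc-head (path 1)   hub₁              = s≤s z≤n
    δ-arc-head (path (suc (suc j))) (hub₁ {c}) = δpc-upper j c
    δ-arc-head (path 0)   (spoke _)         = s≤s z≤n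
    δ-arc-head (path 1)   (spoke _)         = s≤s z≤n
    δ-arc-head (path (suc (suc j))) (spoke c<k) =
      ≤-reflexive (trans (δpc-spoke j c<k) (cong suc (sym (∣-∣-identityʳ j))))
    δ-arc-head (clique c) (clique-clique {b = b} _) = ≤-trans (δ-clique≤1 c b) (s≤s z≤n)
    δ-arc-head (clique c) (hub₀ {b})        = ≤-trans (δ-clique≤1 c b) (s≤s z≤n)
    δ-arc-head (clique c) (hub₁ {b})        = ≤-trans (δ-clique≤1 c b) (s≤s z≤n)
    δ-arc-head (clique c) (spoke {b} _)     = ≤-trans (δ-clique≤1 c b) (s≤s z≤n)

    δ-arc-tail : ∀ x {y z} → Arc y z → δ x y ≤ suc (δ x z)
    δ-arc-tail (path a)   (path-step {i})   = ∣m-n∣≤1+∣m-1+n∣ a i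
    δ-arc-tail (clique c) (path-step {i})   = m≤n⇒m≤1+n (δpc-step i c)
    δ-arc-tail x          (clique-clique a≢b) = δ-arc-head x (clique-clique (≢-sym a≢b))
    δ-arc-tail (path a)   (hub₀ {c})        = subst (_≤ suc (δpc a c)) (sym (∣-∣-identityʳ a)) (≤1+δpc a c)
    δ-arc-tail (path 0)   hub₁              = s≤s z≤n
    δ-arc-tail (path 1)   hub₁              = z≤n
    δ-arc-tail (path (suc (suc j))) (hub₁ {c}) = s≤s (≤-trans (n≤1+n j) (δpc-lower j c))
    δ-arc-tail (path 0)   (spoke _)         = ≤-refl
    δ-arc-tail (path 1)   (spoke _)         = s≤s z≤n
    δ-arc-tail (path (suc (suc j))) (spoke {c} _) =
      ≤-trans (≤-reflexive (∣-∣-identityʳ j)) (m≤n⇒m≤1+n (≤-trans (n≤1+n j) (δpc-lower j c)))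
    δ-arc-tail (clique c) hub₀              = s≤s z≤n
    δ-arc-tail (clique c) hub₁              = s≤s z≤n
    δ-arc-tail (clique c) (spoke {b} b<k) with c ≟ b
    ... | yes refl = ≤-trans (≤-reflexive (δpc-spoke 0 b<k)) (s≤s z≤n)
    ... | no  c≢b  = ≤-trans (δpc-upper 0 c) (s≤s (≤-reflexive (sym (ind-true (from T-not-≡ᵇ (≢-sym c≢b))))))

    δ-pred : ∀ x y {t} → Valid x → Valid y → δ x y ≡ suc t → ∃[ z ] Valid z × Adj z y × δ x z ≡ t
    δ-pred (path i) (path j) vx vy eq with ∣m-n∣≡1+t i j eq
    ... | inj₁ (j′ , refl , eq′) = path j′ , ≤-trans (n≤1+n j′) vy , inj₁ path-step , eq′
    ... | inj₂ (j<i , eq′)       = path (suc j) , ≤-trans j<i vx , inj₂ path-step , eq′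
    δ-pred (path 0) (clique c) _ _ refl = path 0 , z≤n , inj₁ hub₀ , refl
    δ-pred (path 1) (clique c) _ _ refl = path 1 , s≤s z≤n , inj₁ hub₁ , refl
    δ-pred (path (suc (suc j))) (clique c) _ _ eq with c <ᵇ k in c<ᵇk
    ... | true  = path 2 , s≤s (s≤s z≤n) , inj₁ (spoke (to T-<ᵇ (from T-≡ c<ᵇk))) ,
                  trans (∣-∣-identityʳ j) (trans (sym (+-identityʳ j)) (suc-injective eq))
    ... | false = path 1 , s≤s z≤n , inj₁ hub₁ , trans (+-comm 1 j) (suc-injective eq)
    δ-pred (clique c) (path 0) vx _ refl = clique c , vx , inj₂ hub₀ , δ-self (clique c)
    δ-pred (clique c) (path 1) vx _ refl = clique c , vx , inj₂ hub₁ , δ-self (clique c)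
    δ-pred (clique c) (path 2) vx _ eq with c <ᵇ k in c<ᵇk
    ... | true  = clique c , vx , inj₂ (spoke (to T-<ᵇ (from T-≡ c<ᵇk))) , trans (δ-self (clique c)) (suc-injective eq)
    ... | false = path 1 , s≤s z≤n , inj₁ path-step , suc-injective eq
    δ-pred (clique c) (path (suc (suc (suc j)))) _ vy eq =
      path (suc (suc j)) , ≤-trans (n≤1+n _) vy , inj₁ path-step , suc-injective eq
    δ-pred (clique a) (clique b) va _ eq with b ≡ᵇ a in b≡ᵇa
    ... | false = clique a , va , inj₁ (clique-clique (≢-sym (to T-not-≡ᵇ (from T-not-≡ b≡ᵇa)))) ,
                  trans (δ-self (clique a)) (suc-injective eq)

    eccentricity : Vertex → ℕ
    eccentricity (path i)   = i ⊔ (D ∸ i)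
    eccentricity (clique c) = δpc D c

    δ≤eccentricity : ∀ x y → Valid x → Valid y → δ x y ≤ eccentricity x
    δ≤eccentricity (path i) (path j) vx vy with ≤-total i j
    ... | inj₁ i≤j = ≤-trans (≤-reflexive (m≤n⇒∣m-n∣≡n∸m i≤j)) (≤-trans (∸-monoˡ-≤ i vy) (m≤n⊔m i (D ∸ i)))
    ... | inj₂ j≤i = ≤-trans (≤-reflexive (m≤n⇒∣n-m∣≡n∸m j≤i)) (≤-trans (m∸n≤m i j) (m≤m⊔n i (D ∸ i)))
    δ≤eccentricity (path 0)             (clique c) _ _ = s≤s z≤n
    δ≤eccentricity (path 1)             (clique c) _ _ = m≤m⊔n 1 (D ∸ 1)
    δ≤eccentricity (path (suc (suc j))) (clique c) _ _ = ≤-trans (δpc-upper j c) (m≤m⊔n (suc (suc j)) (D ∸ suc (suc j)))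
    δ≤eccentricity (clique c) (path j)   _  vy = δpc-mono c vy
    δ≤eccentricity (clique a) (clique b) _  _  = ≤-trans (δ-clique≤1 a b) (δpc-pos D a)

    eccentricity-attained : ∀ x → Valid x → ∃[ y ] Valid y × δ x y ≡ eccentricity x
    eccentricity-attained (path i) vx with i ≤? D ∸ i
    ... | yes i≤D-i = path D , ≤-refl , trans (m≤n⇒∣m-n∣≡n∸m vx) (sym (m≤n⇒m⊔n≡n i≤D-i))
    ... | no  i≰D-i = path 0 , z≤n , trans (∣-∣-identityʳ i) (sym (m≥n⇒m⊔n≡m (≰⇒≥ i≰D-i)))
    eccentricity-attained (clique c) _ = path D , ≤-refl , refl

    eccentricity<N : ∀ x → Valid x → eccentricity x < N
    eccentricity<N (path i)   vx = ≤-trans (s≤s (⊔-lub vx (m∸n≤m D i))) (m≤m+n (suc D) m)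
    eccentricity<N (clique c) _  = ≤-trans (s≤s (δpc-upper (suc e) c)) (m≤m+n (suc D) m)

    d : Fin N → Fin N → ℕ
    d v w = δ (vertex v) (vertex w)

    d-edge : ∀ v {u w} → T (G u w) → d v w ≤ suc (d v u)
    d-edge v {u} {w} t with to (T-G u w) t
    ... | inj₁ arc = δ-arc-head (vertex v) arc
    ... | inj₂ arc = δ-arc-tail (vertex v) arc

    d-pred : ∀ v w {t} → d v w ≡ suc t → ∃[ u ] T (G u w) × d v u ≡ t
    d-pred v w eq with δ-pred (vertex v) (vertex w) (valid-vertex v) (valid-vertex w) eq
    ... | z , vz , adj , δ≡t = index z vz ,
          from (T-G (index z vz) w) (subst (λ y → Adj y (vertex w)) (sym (vertex-index z vz)) adj) ,
          trans (cong (δ (vertex v)) (vertex-index z vz)) δ≡t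

    d<N : ∀ v w → d v w < N
    d<N v w = ≤-<-trans (δ≤eccentricity (vertex v) (vertex w) (valid-vertex v) (valid-vertex w))
                        (eccentricity<N (vertex v) (valid-vertex v))

    open DistanceCharacterisation G d (δ-self ∘ vertex) (vertex-injective ∘ δ≡0⇒≡ _ _) d-edge d-pred
      using (dist≡)

    ecc≡eccentricity : ∀ v → ecc G v ≡ eccentricity (vertex v)
    ecc≡eccentricity v with eccentricity-attained (vertex v) (valid-vertex v)
    ... | y , vy , δ≡ecc = ecc≡ G v
      (λ w → subst (_≤ eccentricity (vertex v)) (sym (dist≡ d<N v w))
                   (δ≤eccentricity (vertex v) (vertex w) (valid-vertex v) (valid-vertex w)))
      (index y vy , trans (dist≡ d<N v (index y vy)) (trans (cong (δ (vertex v)) (vertex-index y vy)) δ≡ecc))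

    degree : Vertex → ℕ
    degree (path 0)                   = suc m
    degree (path 1)                   = 2 + m
    degree (path 2)                   = 2 + k
    degree (path (suc (suc (suc j)))) = suc (ind (j <ᵇ e))
    degree (clique c)                 = suc (ind (c <ᵇ k) + m)

    path-neighbours : ∀ i → ∑[ j < suc D ] ind (adjᵇ (path i) (path j))
                          ≡ ind (suc i <ᵇ suc D) + ∑[ j < suc D ] ind (suc j ≡ᵇ i)
    path-neighbours i = begin
      ∑[ j < suc D ] ind ((j ≡ᵇ suc i) ∨ (suc j ≡ᵇ i))
        ≡⟨ ∑-cong (suc D) (λ j _ → ind-∨ _ _ (disjoint j)) ⟩
      ∑[ j < suc D ] (ind (j ≡ᵇ suc i) + ind (suc j ≡ᵇ i))
        ≡⟨ ∑-distrib-+ (suc D) (λ j → ind (j ≡ᵇ suc i)) (λ j → ind (suc j ≡ᵇ i)) ⟩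
      ∑[ j < suc D ] ind (j ≡ᵇ suc i) + ∑[ j < suc D ] ind (suc j ≡ᵇ i)
        ≡⟨ cong (_+ ∑[ j < suc D ] ind (suc j ≡ᵇ i)) (∑-ind-≡ᵇ (suc D) (suc i)) ⟩
      ind (suc i <ᵇ suc D) + ∑[ j < suc D ] ind (suc j ≡ᵇ i) ∎
      where
      open ≡-Reasoning
      disjoint : ∀ j → ¬ (T (j ≡ᵇ suc i) × T (suc j ≡ᵇ i))
      disjoint j (j≡1+i , 1+j≡i) with refl ← to (T-≡ᵇ {j}) j≡1+i =
        <-irrefl (sym (to (T-≡ᵇ {suc j}) 1+j≡i)) (m<n⇒m<1+n (n<1+n i))

    neighbours≡degree : ∀ x → Valid x →
      ∑[ i < suc D ] ind (adjᵇ x (path i)) + ∑[ c < m ] ind (adjᵇ x (clique c)) ≡ degree x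
    neighbours≡degree (path 0) _ =
      cong₂ _+_ (trans (path-neighbours 0) (cong (1 +_) (∑-zero (suc D)))) (∑-ones m)
    neighbours≡degree (path 1) _ =
      cong₂ _+_ (trans (path-neighbours 1) (cong (1 +_) (∑-ind-≡ᵇ (suc D) 0))) (∑-ones m)
    neighbours≡degree (path 2) _ =
      cong₂ _+_ (trans (path-neighbours 2) (cong (1 +_) (∑-ind-≡ᵇ (suc D) 1))) (∑-ind-<ᵇ k r)
    neighbours≡degree (path (suc (suc (suc j)))) vx = begin
      ∑[ i < suc D ] ind (adjᵇ (path (3 + j)) (path i)) + ∑[ _ < m ] 0 ≡⟨ cong₂ _+_ (path-neighbours (3 + j)) (∑-zero m) ⟩
      ind (j <ᵇ e) + ∑[ i < suc D ] ind (suc i ≡ᵇ 3 + j) + 0           ≡⟨ +-identityʳ _ ⟩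
      ind (j <ᵇ e) + ∑[ i < suc D ] ind (suc i ≡ᵇ 3 + j)               ≡⟨ cong (ind (j <ᵇ e) +_) (∑-ind-≡ᵇ (suc D) (2 + j)) ⟩
      ind (j <ᵇ e) + ind (2 + j <ᵇ suc D)                              ≡⟨ cong (ind (j <ᵇ e) +_) (ind-true (from T-<ᵇ (m≤n⇒m≤1+n vx))) ⟩
      ind (j <ᵇ e) + 1                                                 ≡⟨ +-comm (ind (j <ᵇ e)) 1 ⟩
      suc (ind (j <ᵇ e))                                               ∎
      where open ≡-Reasoning
    neighbours≡degree (clique c) vc = begin
      2 + (ind (c <ᵇ k) + ∑[ _ < suc e ] 0) + X ≡⟨ cong (λ z → 2 + (ind (c <ᵇ k) + z) + X) (∑-zero (suc e)) ⟩
      2 + (ind (c <ᵇ k) + 0) + X                ≡⟨ regroup (ind (c <ᵇ k)) X ⟩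
      suc (ind (c <ᵇ k) + (X + 1))              ≡⟨ cong (λ z → suc (ind (c <ᵇ k) + z)) (∑-ind-≢ vc) ⟩
      suc (ind (c <ᵇ k) + m)                    ∎
      where
      open ≡-Reasoning
      X : ℕ
      X = ∑[ c′ < m ] ind (not (c′ ≡ᵇ c))
      regroup : ∀ a x → 2 + (a + 0) + x ≡ suc (a + (x + 1))
      regroup = solve-∀

    deg≡degree : ∀ v → deg G v ≡ degree (vertex v)
    deg≡degree v = begin
      deg G v                                    ≡⟨ deg≡∑ G v (ind ∘ edge (toℕ v)) (λ _ → refl) ⟩
      ∑[ b < N ] ind (edge (toℕ v) b)            ≡⟨ cong (λ a → ∑[ b < N ] ind (edge a b)) (sym (label-vertex v)) ⟩
      ∑[ b < N ] ind (edge (label x) b)          ≡⟨ ∑-split (suc D) m (ind ∘ edge (label x)) ⟩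
      ∑[ i < suc D ] ind (edge (label x) i) + ∑[ c < m ] ind (edge (label x) (suc D + c))
        ≡⟨ cong₂ _+_ (∑-cong (suc D) (λ i i<1+D → ind-edge {y = path i} vx (≤-pred i<1+D)))
                     (∑-cong m (λ c c<m → ind-edge {y = clique c} vx c<m)) ⟩
      ∑[ i < suc D ] ind (adjᵇ x (path i)) + ∑[ c < m ] ind (adjᵇ x (clique c))
        ≡⟨ neighbours≡degree x vx ⟩
      degree x                                   ∎
      where
      open ≡-Reasoning
      x = vertex v
      vx = valid-vertex v

    contribution : Vertex → ℕ
    contribution x = degree x * eccentricity x

    ξᶜ≡contributions : ξᶜ G ≡ ∑[ i < suc D ] contribution (path i) + ∑[ c < m ] contribution (clique c)
    ξᶜ≡contributions = begin
      ξᶜ G                                 ≡⟨ ξᶜ≡∑ G (contribution ∘ vertexOf) (λ v → cong₂ _*_ (deg≡degree v) (ecc≡eccentricity v)) ⟩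
      ∑[ a < N ] contribution (vertexOf a) ≡⟨ ∑-split (suc D) m (contribution ∘ vertexOf) ⟩
      ∑[ i < suc D ] contribution (vertexOf i) + ∑[ c < m ] contribution (vertexOf (suc D + c))
        ≡⟨ cong₂ _+_ (∑-cong (suc D) (λ i i<1+D → cong contribution (vertexOf-label (path i) (≤-pred i<1+D))))
                     (∑-cong m (λ c c<m → cong contribution (vertexOf-label (clique c) c<m))) ⟩
      ∑[ i < suc D ] contribution (path i) + ∑[ c < m ] contribution (clique c) ∎
      where open ≡-Reasoning

    inner-eccentricities : ℕ
    inner-eccentricities = sum (map (eccentricity ∘ path) (applyUpTo (3 +_) e))

    path-contributions : ∑[ i < suc D ] contribution (path i)
      ≡ (1 + m) * D + ((2 + m) * (2 + e) + ((2 + k) * (2 ⊔ suc e) + (2 * inner-eccentricities + 1 * D)))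
    path-contributions = cong (λ z → (1 + m) * D + ((2 + m) * (2 + e) + ((2 + k) * (2 ⊔ suc e) + z))) (begin
      ∑[ j < suc e ] contribution (path (3 + j))
        ≡⟨ ∑-last e (contribution ∘ path ∘ (3 +_)) ⟩
      ∑[ j < e ] (suc (ind (j <ᵇ e)) * eccentricity (path (3 + j))) + suc (ind (e <ᵇ e)) * eccentricity (path D)
        ≡⟨ cong₂ _+_ (∑-cong e (λ j j<e → cong (λ b → suc b * eccentricity (path (3 + j))) (ind-true (from T-<ᵇ j<e))))
                     (cong₂ _*_ (cong suc (ind-false {e <ᵇ e} (<-irrefl refl ∘ to (T-<ᵇ {e} {e})))) eccentricity-end) ⟩
      ∑[ j < e ] (2 * eccentricity (path (3 + j))) + 1 * D
        ≡⟨ cong (_+ 1 * D) (∑-*ˡ e 2 (eccentricity ∘ path ∘ (3 +_))) ⟩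
      2 * ∑[ j < e ] eccentricity (path (3 + j)) + 1 * D
        ≡⟨ cong (λ z → 2 * z + 1 * D) (sym (∑-applyUpTo (eccentricity ∘ path) (3 +_) e)) ⟩
      2 * inner-eccentricities + 1 * D ∎)
      where
      open ≡-Reasoning
      eccentricity-end : eccentricity (path D) ≡ D
      eccentricity-end = trans (cong (D ⊔_) (n∸n≡0 D)) (⊔-identityʳ D)

    clique-contributions : ∑[ c < m ] contribution (clique c) ≡ k * ((2 + m) * (2 + e)) + r * ((1 + m) * D)
    clique-contributions = trans (∑-cong m (λ c _ → by-spoke c)) (∑-if-<ᵇ k r _ _)
      where
      by-spoke : ∀ c → contribution (clique c) ≡ (if c <ᵇ k then (2 + m) * (2 + e) else (1 + m) * D)
      by-spoke c with c <ᵇ k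
      ... | true  = cong ((2 + m) *_) (+-identityʳ (2 + e))
      ... | false = cong ((1 + m) *_) (+-comm (2 + e) 1)

    ξᶜ≡ : ξᶜ G ≡ (1 + m) * D + ((2 + m) * (2 + e) + ((2 + k) * (2 ⊔ suc e) + (2 * inner-eccentricities + 1 * D)))
               + (k * ((2 + m) * (2 + e)) + r * ((1 + m) * D))
    ξᶜ≡ = trans ξᶜ≡contributions (cong₂ _+_ path-contributions clique-contributions)

open import Data.Nat using (ℕ; zero; suc; _≤_; _∸_; _⊔_; s≤s; z≤n)
import Data.Nat as ℕ
open import Data.Nat.Properties using (m≤n⇒∃[o]m+o≡n)
open import Data.Integer using (ℤ; +_; _+_; _*_; _-_)
open import Data.Integer.Properties using (pos-*)
open import Data.Integer.Tactic.RingSolver using (solve-∀)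
open import Data.Product using (_,_)
open import Relation.Binary.PropositionalEquality using (_≡_; refl; trans; cong; cong₂; subst)

rearrange : ∀ (E K R X T : ℤ) →
  (+ 1 + (K + R)) * (+ 3 + E) + ((+ 2 + (K + R)) * (+ 2 + E) + ((+ 2 + K) * X + (+ 2 * T + + 1 * (+ 3 + E))))
    + (K * ((+ 2 + (K + R)) * (+ 2 + E)) + R * ((+ 1 + (K + R)) * (+ 3 + E)))
  ≡ + 2 * ((+ 3 + E) + ((+ 2 + E) + (X + T)))
    + ((+ 4 + (E + (K + R))) - (+ 3 + E) - + 1) * (+ 2 * (+ 3 + E) - + 1 + (+ 3 + E) * ((+ 4 + (E + (K + R))) - (+ 3 + E)))
    + K * (+ 2 * (+ 3 + E) - (+ 4 + (E + (K + R))) - + 1 + X)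
rearrange = solve-∀

lemma2 : (n D k : ℕ) → 4 ≤ n → 3 ≤ D → D ≤ n ∸ 1 → k ≤ n ∸ D ∸ 1 →
    + ξᶜ (Gndk n D k)
      ≡ + 2 * + sumMax D
        + (+ n - + D - + 1) * (+ 2 * + D - + 1 + + D * (+ n - + D))
        + + k * (+ 2 * + D - + n - + 1 + + (2 ⊔ (D ∸ 2)))
lemma2 zero _ _ ()
lemma2 (suc n) (suc (suc (suc e))) k _ (s≤s (s≤s (s≤s z≤n))) D≤n k≤n-D-1
  with size , refl ← m≤n⇒∃[o]m+o≡n D≤n
  with r , refl ← m≤n⇒∃[o]m+o≡n (subst (k ≤_) (1+m+n∸m∸1≡n e size) k≤n-D-1) =
  trans (cong +_ ξᶜ≡)
        -- +_ commutes with addition definitionally; only the products need pos-*.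
        (trans (cong₂ _+_
                 (cong₂ _+_ (pos-* (1 ℕ.+ m) D) (cong₂ _+_ (pos-* (2 ℕ.+ m) (2 ℕ.+ e))
                   (cong₂ _+_ (pos-* (2 ℕ.+ k) x) (cong₂ _+_ (pos-* 2 t) (pos-* 1 D)))))
                 (cong₂ _+_ (trans (pos-* k _) (cong (+ k *_) (pos-* (2 ℕ.+ m) (2 ℕ.+ e))))
                            (trans (pos-* r _) (cong (+ r *_) (pos-* (1 ℕ.+ m) D)))))
               (rearrange (+ e) (+ k) (+ r) (+ x) (+ t)))
  where
  open Model e k r using (m; D; ξᶜ≡)
  x t : ℕ
  x = 2 ⊔ suc e
  t = Model.inner-eccentricities e k r
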